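{- Let $n\ge 2$ and $d$ be positive integers with $d\le n$, let $\lambda\vdash n$, and let $T$ be a standard Young tableau of shape $\lambda$. Then the label $\max(n-d,1)$ lies under the path $\pi(T,n)$ if and only if $n-1$ and $n$ form a descent in $\Psi^{(d)}(T)$, i.e. $n$ lies in a strictly higher row of $\Psi^{(d)}(T)$ than $n-1$.
   Context: Young diagrams are drawn in French convention: the cell in row $r$ (rows numbered $1,2,\dots$ from the bottom) and column $c$ (columns numbered from the left) is the unit square $[c-1,c]\times[r-1,r]$, and row $r$ of the diagram of $\lambda$ has $\lambda_r$ cells. A standard Young tableau of shape $\lambda\vdash n$ is a bijective filling of the cells with $1,\dots,n$ increasing along rows (left to right) and up columns. The path $\pi(T,k)$: start at the lower-left corner of the cell containing $k$. At a current lattice point $(x,y)$, let $L$ be the cell $[x-1,x]\times[y,y+1]$ and $B$ the cell $[x,x+1]\times[y-1,y]$ (each only if it is in the diagram). If both exist, step left to $(x-1,y)$ if the entry of $L$ exceeds that of $B$, otherwise step down to $(x,y-1)$; if only $L$ exists step left; if only $B$ exists step down; if neither exists, stop. If $k$ is in row $r_k$, then for each row $r<r_k$ the path has exactly one down-step from height $r$ to $r-1$, at $x$-coordinate $x_r$; a cell in row $r$, column $c$ is under the path if $r<r_k$ and $c-1\ge x_r$, and otherwise not under it. Two labels lie on the same side of the path if both or neither of their cells are under it. For a tableau $T$ and $1\le k\le n$, let $m=\max(k-d,1)$ and define $\Psi^{(d)}_k(T)$ as follows (it equals $T$ if $k\le 2$): partition the labels $m,m+1,\dots,k-1$ into maximal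 blocks of consecutive integers $\{a,a+1,\dots,a+j\}$ such that $a$ lies on the same side of $\pi(T,k)$ as $m$ and $a+1,\dots,a+j$ all lie on the other side; in each block write $a$ into the cell of $a+1$, $a+1$ into the cell of $a+2$, \dots, $a+j-1$ into the cell of $a+j$, and $a+j$ into the cell of $a$; all other labels stay in place. Finally $\Psi^{(d)}(T)=\Psi^{(d)}_1(\Psi^{(d)}_2(\cdots\Psi^{(d)}_n(T)\cdots))$, i.e. $\Psi^{(d)}_n$ is applied first and $\Psi^{(d)}_1$ last, each to the result of the previous step. -}

module Defs where

open import Data.Nat using (ℕ; zero; suc; _+_; _∸_; _≤_; _<_; _≥_; _⊔_; _≡ᵇ_; _<ᵇ_; _≤ᵇ_; pred)
open import Data.Bool using (Bool; true; false; if_then_else_; _∧_; not; _xor_)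
open import Data.Nat.ListAction using (sum)
open import Data.List using (List; []; _∷_; map; concat; concatMap; upTo; zip; length)
open import Data.List.Relation.Unary.All using (All)
open import Data.List.Relation.Unary.Linked using (Linked)
open import Data.List.Relation.Binary.Permutation.Propositional using (_↭_)
open import Data.Maybe using (Maybe; just; nothing; _>>=_)
open import Data.Product using (_×_; _,_; proj₁)
open import Relation.Binary.PropositionalEquality using (_≡_)

IsPartition : List ℕ → ℕ → Set
IsPartition sh n = All (λ p → 1 ≤ p) sh × Linked _≥_ sh × sum sh ≡ n

-- A tableau is its list of rows, bottom row (row 1) first;
-- each row lists its entries from left (column 1) to right.
Tableau : Set
Tableau = List (List ℕ)

-- 1-based list access (index 0 is never valid).
at : {A : Set} → List A → ℕ → Maybe A
at xs zero = nothing
at [] (suc i) = nothing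
at (x ∷ xs) (suc zero) = just x
at (x ∷ xs) (suc (suc i)) = at xs (suc i)

entry : Tableau → ℕ → ℕ → Maybe ℕ
entry T r c = at T r >>= λ row → at row c

IsSYT : List ℕ → Tableau → Set
IsSYT sh T =
  (map length T ≡ sh)
  × (concat T ↭ map suc (upTo (sum sh)))
  × (∀ r c a b → entry T r c ≡ just a → entry T r (suc c) ≡ just b → a < b)
  × (∀ r c a b → entry T r c ≡ just a → entry T (suc r) c ≡ just b → a < b)

findIn : ℕ → List ℕ → ℕ → Maybe ℕ
findIn k [] c = nothing
findIn k (x ∷ xs) c = if k ≡ᵇ x then just c else findIn k xs (suc c)

posFrom : ℕ → Tableau → ℕ → Maybe (ℕ × ℕ)
posFrom k [] r = nothing
posFrom k (row ∷ rows) r with findIn k row 1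
... | just c = just (r , c)
... | nothing = posFrom k rows (suc r)

pos : Tableau → ℕ → Maybe (ℕ × ℕ)
pos T k = posFrom k T 1

-- row of a label (0 if absent, which never happens for tableaux)
rowOf : Tableau → ℕ → ℕ
rowOf T k with pos T k
... | just (r , _) = r
... | nothing = 0

data Step : Set where
  left down stop : Step

-- At lattice point (x,y): L = cell [x-1,x]×[y,y+1] = row y+1, column x;
-- B = cell [x,x+1]×[y-1,y] = row y, column x+1.
stepAt : Tableau → ℕ → ℕ → Step
stepAt T x y with entry T (suc y) x | entry T y (suc x)
... | just l | just b = if b <ᵇ l then left else down
... | just _ | nothing = left
... | nothing | just _ = down
... | nothing | nothing = stop

-- x-coordinate of the down-step of the path (started at (x,y)) going from
-- height r to r-1, if any.  The fuel argument bounds the number of steps.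
downX : ℕ → Tableau → ℕ → ℕ → ℕ → Maybe ℕ
downX zero T x y r = nothing
downX (suc f) T x y r with stepAt T x y
... | stop = nothing
... | left = downX f T (pred x) y r
... | down = if y ≡ᵇ r then just x else downX f T x (pred y) r

-- Is the cell of label ℓ under the path π(T,k)?
-- (cell in row r, column c: r < r_k and c-1 ≥ x_r)
underB : Tableau → ℕ → ℕ → Bool
underB T k ℓ with pos T k | pos T ℓ
... | just (rk , ck) | just (r , c) =
      if r <ᵇ rk
      then (let x0 = ck ∸ 1 ; y0 = rk ∸ 1 in
            helper (downX (suc (x0 + y0)) T x0 y0 r) (c ∸ 1))
      else false
  where
  helper : Maybe ℕ → ℕ → Bool
  helper (just xr) c' = xr ≤ᵇ c'
  helper nothing c' = false
... | _ | _ = false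

-- maximal blocks of the list of labels: a new block starts at each label on
-- the same side as the reference side s0; other labels join the preceding block.
blocks : (ℕ → Bool) → Bool → List ℕ → List (List ℕ) × List ℕ
blocks side s0 [] = ([] , [])
blocks side s0 (i ∷ rest) with blocks side s0 rest
... | (bs , pend) = if not (side i xor s0) then (((i ∷ pend) ∷ bs) , []) else (bs , (i ∷ pend))

lastOf : ℕ → List ℕ → ℕ
lastOf a [] = a
lastOf a (x ∷ xs) = lastOf x xs

-- For block a, a+1, ..., a+j: pairs (old label in a cell , new label in it):
-- a is written into the cell of a+1, ..., a+j into the cell of a.
cyclePairs : List ℕ → List (ℕ × ℕ)
cyclePairs [] = []
cyclePairs (a ∷ xs) = (a , lastOf a xs) ∷ zip xs (a ∷ xs)

relabel : List (ℕ × ℕ) → ℕ → ℕ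
relabel [] b = b
relabel ((o , nw) ∷ ps) b = if b ≡ᵇ o then nw else relabel ps b

psiK : ℕ → ℕ → Tableau → Tableau
psiK d k T =
  if k ≤ᵇ 2 then T
  else map (map (relabel (concatMap cyclePairs (proj₁ (blocks side (side m) labels))))) T
  where
  m : ℕ
  m = (k ∸ d) ⊔ 1
  labels : List ℕ
  labels = map (m +_) (upTo (k ∸ m))
  side : ℕ → Bool
  side i = underB T k i

-- Ψ^{(d)} = Ψ_1 ∘ Ψ_2 ∘ ... ∘ Ψ_n  (Ψ_n applied first)
psi : ℕ → ℕ → Tableau → Tableau
psi d zero T = T
psi d (suc k) T = psi d k (psiK d (suc k) T)

module Submission where

-- Write m = max(n-d, 1) and let a be the last label of m, ..., n-1
-- lying on the same side of the path π(T,n) as m.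
--  * Every Ψ_k relabels the tableau by a permutation of the labels m, ..., k-1
--    (a product of block cycles), so Ψ_{n-1}, ..., Ψ_1 fix n-1 and n, while Ψ_n
--    fixes n and writes n-1 into the cell of a: the block opened by a runs up to
--    n-1.  Hence n-1 and n lie in Ψ^{(d)}(T) in the rows of a and n in T.
--  * If a is under π(T,n), it lies in a lower row than n by definition.  If a is
--    not under the path but all labels between a and n are, then n does not lie
--    above a: otherwise the label b above a is under the path, so the down-steps
--    x_r, x_{r+1} of the path at the heights of a and b satisfy
--    x_{r+1} ≤ c-1 < x_r for the column c of a, contradicting x_r ≤ x_{r+1}.

open import Defs
open import Data.Bool using (Bool; true; false; T; not; _xor_; _∨_; if_then_else_)
open import Data.Bool.Properties using (T-≡) renaming (_≟_ to _≟ᵇ_)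
open import Data.Empty using (⊥; ⊥-elim)
open import Data.List using (List; []; _∷_; _++_; map; concat; concatMap; upTo; applyUpTo; zip; length)
open import Data.List.Membership.Propositional using (_∈_; _∉_)
open import Data.List.Membership.Propositional.Properties
  using (∈-concat⁺′; ∈-concat⁻′; ∈-map⁺; ∈-map⁻; ∈-upTo⁺; ∈-upTo⁻)
open import Data.List.Properties using (map-upTo; map-id; map-∘; map-cong)
open import Data.List.Relation.Binary.Permutation.Propositional using (_↭_; ↭-sym; ↭⇒↭ₛ)
open import Data.List.Relation.Binary.Permutation.Propositional.Properties using (∈-resp-↭)
open import Data.List.Relation.Binary.Permutation.Setoid.Properties using (Unique-resp-↭)
open import Data.List.Relation.Unary.All using (lookup)
import Data.List.Relation.Unary.All.Properties as All
open import Data.List.Relation.Unary.AllPairs using ([]; _∷_)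
open import Data.List.Relation.Unary.Any using (here; there)
open import Data.List.Relation.Unary.Linked using (Linked; _∷_)
open import Data.List.Relation.Unary.Unique.Propositional using (Unique)
import Data.List.Relation.Unary.Unique.Propositional.Properties as Unique
open import Data.Maybe using (Maybe; just; nothing)
open import Data.Maybe.Properties using (just-injective)
open import Data.Nat using (ℕ; zero; suc; pred; _+_; _∸_; _≤_; _<_; _≥_; _⊔_; _≡ᵇ_; _<ᵇ_; _≤ᵇ_; z≤n; s≤s)
open import Data.Nat.ListAction using (sum)
open import Data.Nat.Properties
open import Data.Product using (Σ; ∃; ∃₂; _×_; _,_; proj₁; proj₂)
open import Data.Sum using (_⊎_; inj₁; inj₂)
open import Function.Base using (_∘_; id)
open import Function.Bundles using (_⇔_; mk⇔; Equivalence)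
open import Function.Definitions using (Injective)
open import Relation.Nullary using (¬_; Dec; yes; no)
open import Relation.Nullary.Decidable using (_×-dec_)
open import Relation.Binary.PropositionalEquality

T⇒≡true : ∀ {b} → T b → b ≡ true
T⇒≡true = Equivalence.to T-≡

≡true⇒T : ∀ {b} → b ≡ true → T b
≡true⇒T = Equivalence.from T-≡

¬T⇒≡false : ∀ {b} → ¬ T b → b ≡ false
¬T⇒≡false {false} _ = refl
¬T⇒≡false {true} ¬t = ⊥-elim (¬t _)

≡false⇒¬T : ∀ {b} → b ≡ false → ¬ T b
≡false⇒¬T refl ()

≢false⇒≡true : ∀ {b} → b ≢ false → b ≡ true
≢false⇒≡true {true}  _   = refl
≢false⇒≡true {false} b≢f = ⊥-elim (b≢f refl)

≡ᵇ-true⇒≡ : ∀ {m n} → (m ≡ᵇ n) ≡ true → m ≡ n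
≡ᵇ-true⇒≡ {m} {n} e = ≡ᵇ⇒≡ m n (≡true⇒T e)

≡⇒≡ᵇ-true : ∀ {m n} → m ≡ n → (m ≡ᵇ n) ≡ true
≡⇒≡ᵇ-true {m} {n} e = T⇒≡true (≡⇒≡ᵇ m n e)

≡ᵇ-false⇒≢ : ∀ {m n} → (m ≡ᵇ n) ≡ false → m ≢ n
≡ᵇ-false⇒≢ {m} {n} e m≡n = ≡false⇒¬T e (≡⇒≡ᵇ m n m≡n)

≢⇒≡ᵇ-false : ∀ {m n} → m ≢ n → (m ≡ᵇ n) ≡ false
≢⇒≡ᵇ-false {m} {n} m≢n = ¬T⇒≡false (λ t → m≢n (≡ᵇ⇒≡ m n t))

≤⇒≤ᵇ-true : ∀ {m n} → m ≤ n → (m ≤ᵇ n) ≡ true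
≤⇒≤ᵇ-true m≤n = T⇒≡true (≤⇒≤ᵇ m≤n)

Within : ℕ → ℕ → ℕ → Set
Within lo hi x = lo ≤ x × x < hi

within? : ∀ lo hi x → Dec (Within lo hi x)
within? lo hi x = lo ≤? x ×-dec x <? hi

within-apart : ∀ {lo mid hi x} → Within lo mid x → Within mid hi x → ⊥
within-apart (_ , x<mid) (mid≤x , _) = <⇒≱ x<mid mid≤x

within-split : ∀ {lo hi x} → Within lo hi x → x ≡ lo ⊎ Within (suc lo) hi x
within-split {lo} {x = x} (l , u) with x ≟ lo
... | yes x≡lo = inj₁ x≡lo
... | no x≢lo  = inj₂ (≤∧≢⇒< l (x≢lo ∘ sym) , u)

record IsLast (colour : ℕ → Bool) (b : Bool) (lo hi a : ℕ) : Set where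
  field
    within : Within lo hi a
    onSide : colour a ≡ b
    after  : ∀ {x} → a < x → x < hi → colour x ≢ b

isLast-narrow : ∀ {colour b lo lo′ hi a} → IsLast colour b lo hi a → lo′ ≤ a → IsLast colour b lo′ hi a
isLast-narrow isLast lo′≤a = record
  { within = lo′≤a , proj₂ (IsLast.within isLast) ; onSide = IsLast.onSide isLast ; after = IsLast.after isLast }

lastOnSide : ∀ (colour : ℕ → Bool) {m k} → m < k → ∃ λ a → IsLast colour (colour m) m k a
lastOnSide colour {m} {suc k} m<k with colour k ≟ᵇ colour m
... | yes k-same = k , record { within = ≤-pred m<k , ≤-refl ; onSide = k-same
                              ; after = λ k<x x≤k → ⊥-elim (<⇒≱ k<x (≤-pred x≤k)) }
... | no k-other with m ≟ k
...   | yes refl = ⊥-elim (k-other refl)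
...   | no m≢k   = a , record { within = l , m≤n⇒m≤1+n u ; onSide = onSide ; after = after′ }
  where
  earlier = lastOnSide colour (≤∧≢⇒< (≤-pred m<k) m≢k)
  a = proj₁ earlier
  open IsLast (proj₂ earlier)
  l = proj₁ within
  u = proj₂ within
  after′ : ∀ {x} → a < x → x < suc k → colour x ≢ colour m
  after′ {x} a<x x≤k with x ≟ k
  ... | yes refl = k-other
  ... | no x≢k   = after a<x (≤∧≢⇒< (≤-pred x≤k) x≢k)

isOld : ℕ → List (ℕ × ℕ) → Bool
isOld x [] = false
isOld x ((o , _) ∷ ps) = if x ≡ᵇ o then true else isOld x ps

relabel-fresh : ∀ x ps → isOld x ps ≡ false → relabel ps x ≡ x
relabel-fresh x [] _ = refl
relabel-fresh x ((o , _) ∷ ps) e with x ≡ᵇ o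
relabel-fresh x ((o , _) ∷ ps) () | true
relabel-fresh x ((o , _) ∷ ps) e  | false = relabel-fresh x ps e

isOld-++ : ∀ x ps qs → isOld x (ps ++ qs) ≡ isOld x ps ∨ isOld x qs
isOld-++ x [] qs = refl
isOld-++ x ((o , _) ∷ ps) qs with x ≡ᵇ o
... | true = refl
... | false = isOld-++ x ps qs

relabel-++ : ∀ x ps qs →
  relabel (ps ++ qs) x ≡ (if isOld x ps then relabel ps x else relabel qs x)
relabel-++ x [] qs = refl
relabel-++ x ((o , _) ∷ ps) qs with x ≡ᵇ o
... | true = refl
... | false = relabel-++ x ps qs

relabel-++ˡ : ∀ {x} ps qs → isOld x ps ≡ true → relabel (ps ++ qs) x ≡ relabel ps x
relabel-++ˡ {x} ps qs old rewrite relabel-++ x ps qs | old = refl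

relabel-++ʳ : ∀ {x} ps qs → isOld x ps ≡ false → relabel (ps ++ qs) x ≡ relabel qs x
relabel-++ʳ {x} ps qs fresh rewrite relabel-++ x ps qs | fresh = refl

record Permutes (lo hi : ℕ) (ps : List (ℕ × ℕ)) : Set where
  field
    old⇒within : ∀ {x} → isOld x ps ≡ true → Within lo hi x
    within⇒old : ∀ {x} → Within lo hi x → isOld x ps ≡ true
    stays      : ∀ {x} → Within lo hi x → Within lo hi (relabel ps x)
    injective  : ∀ {x y} → Within lo hi x → Within lo hi y →
                 relabel ps x ≡ relabel ps y → x ≡ y

module _ {lo hi ps} (π : Permutes lo hi ps) where
  open Permutes π

  permutes-fresh : ∀ {x} → ¬ Within lo hi x → isOld x ps ≡ false
  permutes-fresh out = ¬T⇒≡false (out ∘ old⇒within ∘ T⇒≡true)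

  permutes-fixes : ∀ {x} → ¬ Within lo hi x → relabel ps x ≡ x
  permutes-fixes {x} out = relabel-fresh x ps (permutes-fresh out)

  permutes-injective : Injective _≡_ _≡_ (relabel ps)
  permutes-injective {x} {y} e with within? lo hi x | within? lo hi y
  ... | yes wx | yes wy = injective wx wy e
  ... | no ox  | no oy  = trans (sym (permutes-fixes ox)) (trans e (permutes-fixes oy))
  ... | yes wx | no oy  = ⊥-elim (oy (subst (Within lo hi) (trans e (permutes-fixes oy)) (stays wx)))
  ... | no ox  | yes wy = ⊥-elim (ox (subst (Within lo hi) (trans (sym e) (permutes-fixes ox)) (stays wy)))

permutes-[] : ∀ lo → Permutes lo lo []
permutes-[] lo = record
  { old⇒within = λ ()
  ; within⇒old = λ (l , u) → ⊥-elim (<⇒≱ u l)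
  ; stays      = λ (l , u) → ⊥-elim (<⇒≱ u l)
  ; injective  = λ (l , u) _ _ → ⊥-elim (<⇒≱ u l) }

permutes-++ : ∀ {lo mid hi ps qs} → lo ≤ mid → mid ≤ hi →
              Permutes lo mid ps → Permutes mid hi qs → Permutes lo hi (ps ++ qs)
permutes-++ {lo} {mid} {hi} {ps} {qs} lo≤mid mid≤hi π σ = record
  { old⇒within = old⇒within
  ; within⇒old = within⇒old
  ; stays      = stays
  ; injective  = injective }
  where
  module P = Permutes π
  module Q = Permutes σ

  widenˡ : ∀ {x} → Within lo mid x → Within lo hi x
  widenˡ (l , u) = l , <-≤-trans u mid≤hi

  widenʳ : ∀ {x} → Within mid hi x → Within lo hi x
  widenʳ (l , u) = ≤-trans lo≤mid l , u

  halves : ∀ {x} → Within lo hi x → Within lo mid x ⊎ Within mid hi x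
  halves {x} (l , u) with x <? mid
  ... | yes x<mid = inj₁ (l , x<mid)
  ... | no x≮mid  = inj₂ (≮⇒≥ x≮mid , u)

  notOldˡ : ∀ {x} → mid ≤ x → isOld x ps ≡ false
  notOldˡ mid≤x = permutes-fresh π (λ (_ , u) → <⇒≱ u mid≤x)

  relabelˡ : ∀ {x} → Within lo mid x → relabel (ps ++ qs) x ≡ relabel ps x
  relabelˡ w = relabel-++ˡ ps qs (P.within⇒old w)

  relabelʳ : ∀ {x} → Within mid hi x → relabel (ps ++ qs) x ≡ relabel qs x
  relabelʳ (l , _) = relabel-++ʳ ps qs (notOldˡ l)

  old⇒within : ∀ {x} → isOld x (ps ++ qs) ≡ true → Within lo hi x
  old⇒within {x} e with isOld x ps in eps
  ... | true  = widenˡ (P.old⇒within eps)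
  ... | false = widenʳ (Q.old⇒within (trans (sym (cong (_∨ isOld x qs) eps)) (trans (sym (isOld-++ x ps qs)) e)))

  within⇒old : ∀ {x} → Within lo hi x → isOld x (ps ++ qs) ≡ true
  within⇒old {x} w with halves w
  ... | inj₁ wl rewrite isOld-++ x ps qs | P.within⇒old wl = refl
  ... | inj₂ wr rewrite isOld-++ x ps qs | notOldˡ (proj₁ wr) = Q.within⇒old wr

  stays : ∀ {x} → Within lo hi x → Within lo hi (relabel (ps ++ qs) x)
  stays w with halves w
  ... | inj₁ wl rewrite relabelˡ wl = widenˡ (P.stays wl)
  ... | inj₂ wr rewrite relabelʳ wr = widenʳ (Q.stays wr)

  injective : ∀ {x y} → Within lo hi x → Within lo hi y →
              relabel (ps ++ qs) x ≡ relabel (ps ++ qs) y → x ≡ y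
  injective wx wy e with halves wx | halves wy
  ... | inj₁ l | inj₁ l' = P.injective l l' (trans (sym (relabelˡ l)) (trans e (relabelˡ l')))
  ... | inj₂ r | inj₂ r' = Q.injective r r' (trans (sym (relabelʳ r)) (trans e (relabelʳ r')))
  ... | inj₁ l | inj₂ r' = ⊥-elim (within-apart (P.stays l)
          (subst (Within mid hi) (trans (sym (relabelʳ r')) (trans (sym e) (relabelˡ l))) (Q.stays r')))
  ... | inj₂ r | inj₁ l' = ⊥-elim (within-apart (P.stays l')
          (subst (Within mid hi) (trans (sym (relabelʳ r)) (trans e (relabelˡ l'))) (Q.stays r)))

data Run : ℕ → ℕ → List ℕ → Set where
  done : ∀ {lo} → Run lo lo []
  next : ∀ {lo hi xs} → Run (suc lo) hi xs → Run lo hi (lo ∷ xs)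

run-≤ : ∀ {lo hi xs} → Run lo hi xs → lo ≤ hi
run-≤ done     = ≤-refl
run-≤ (next r) = <⇒≤ (run-≤ r)

run-applyUpTo : ∀ lo len (f : ℕ → ℕ) → (∀ i → f i ≡ lo + i) → Run lo (lo + len) (applyUpTo f len)
run-applyUpTo lo zero f f≗ rewrite +-identityʳ lo = done
run-applyUpTo lo (suc len) f f≗ rewrite f≗ 0 | +-identityʳ lo | +-suc lo len =
  next (run-applyUpTo (suc lo) len (f ∘ suc) (λ i → trans (f≗ (suc i)) (+-suc lo i)))

run-labels : ∀ {m k} → m ≤ k → Run m k (map (m +_) (upTo (k ∸ m)))
run-labels {m} {k} m≤k rewrite map-upTo (m +_) (k ∸ m) =
  subst (λ hi → Run m hi (applyUpTo (m +_) (k ∸ m))) (m+[n∸m]≡n m≤k) (run-applyUpTo m (k ∸ m) (m +_) (λ _ → refl))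

shift-old⇒within : ∀ {a s xs x} → Run (suc a) s xs → isOld x (zip xs (a ∷ xs)) ≡ true →
                   Within (suc a) s x
shift-old⇒within done ()
shift-old⇒within {a} {x = x} (next r) e with x ≡ᵇ suc a in x≟a+1
... | true  = let x≡a+1 = ≡ᵇ-true⇒≡ {x} {suc a} x≟a+1 in
              ≤-reflexive (sym x≡a+1) , subst (λ y → y < _) (sym x≡a+1) (run-≤ r)
... | false = let (l , u) = shift-old⇒within r e in <⇒≤ l , u

shift-moves : ∀ {a s xs x} → Run (suc a) s xs → Within (suc a) s x →
              isOld x (zip xs (a ∷ xs)) ≡ true × relabel (zip xs (a ∷ xs)) x ≡ pred x
shift-moves done (l , u) = ⊥-elim (<⇒≱ u l)
shift-moves {a} {x = x} (next r) (l , u) with x ≡ᵇ suc a in x≟a+1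
... | true  = refl , sym (cong pred (≡ᵇ-true⇒≡ {x} {suc a} x≟a+1))
... | false = shift-moves r (≤∧≢⇒< l (≡ᵇ-false⇒≢ {x} {suc a} x≟a+1 ∘ sym) , u)

lastOf-run : ∀ {a s xs} → Run (suc a) s xs → lastOf a xs ≡ pred s
lastOf-run done     = refl
lastOf-run (next r) = lastOf-run r

cycle-head : ∀ {a s xs} → Run (suc a) s xs → relabel (cyclePairs (a ∷ xs)) a ≡ pred s
cycle-head {a} r rewrite ≡⇒≡ᵇ-true {a} refl = lastOf-run r

cycle-tail : ∀ {a s xs x} → Run (suc a) s xs → Within (suc a) s x →
             isOld x (cyclePairs (a ∷ xs)) ≡ true × relabel (cyclePairs (a ∷ xs)) x ≡ pred x
cycle-tail {a} {x = x} r w@(l , _) rewrite ≢⇒≡ᵇ-false (<⇒≢ l ∘ sym) = shift-moves r w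

pred-<-pred : ∀ {a x s} → suc a ≤ x → x < s → pred x < pred s
pred-<-pred {x = suc x} {suc s} _ (s≤s x<s) = x<s

permutes-cycle : ∀ {a s xs} → Run (suc a) s xs → Permutes a s (cyclePairs (a ∷ xs))
permutes-cycle {a} {s} {xs} r = record
  { old⇒within = old⇒within
  ; within⇒old = within⇒old
  ; stays      = stays
  ; injective  = injective }
  where
  a<s : a < s
  a<s = run-≤ r

  top : Within a s (pred s)
  top = pred-mono-≤ a<s , pred-<-pred a<s ≤-refl

  old⇒within : ∀ {x} → isOld x (cyclePairs (a ∷ xs)) ≡ true → Within a s x
  old⇒within {x} e with x ≡ᵇ a in x≟a
  ... | true  = let x≡a = ≡ᵇ-true⇒≡ x≟a in
                ≤-reflexive (sym x≡a) , subst (_< s) (sym x≡a) a<s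
  ... | false = let (l , u) = shift-old⇒within r e in <⇒≤ l , u

  within⇒old : ∀ {x} → Within a s x → isOld x (cyclePairs (a ∷ xs)) ≡ true
  within⇒old w with within-split w
  ... | inj₁ refl rewrite ≡⇒≡ᵇ-true {a} refl = refl
  ... | inj₂ w′ = proj₁ (cycle-tail r w′)

  stays : ∀ {x} → Within a s x → Within a s (relabel (cyclePairs (a ∷ xs)) x)
  stays w with within-split w
  ... | inj₁ refl rewrite cycle-head r = top
  ... | inj₂ w′@(l , u) rewrite proj₂ (cycle-tail r w′) = pred-mono-≤ l , ≤-<-trans pred[n]≤n u

  injective : ∀ {x y} → Within a s x → Within a s y →
              relabel (cyclePairs (a ∷ xs)) x ≡ relabel (cyclePairs (a ∷ xs)) y → x ≡ y
  injective wx wy e with within-split wx | within-split wy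
  ... | inj₁ refl | inj₁ refl = refl
  ... | inj₁ refl | inj₂ w@(l , u) rewrite cycle-head r | proj₂ (cycle-tail r w) =
        ⊥-elim (<⇒≢ (pred-<-pred l u) (sym e))
  ... | inj₂ w@(l , u) | inj₁ refl rewrite cycle-head r | proj₂ (cycle-tail r w) =
        ⊥-elim (<⇒≢ (pred-<-pred l u) e)
  ... | inj₂ w@(l , _) | inj₂ w′@(l′ , _) rewrite proj₂ (cycle-tail r w) | proj₂ (cycle-tail r w′) =
        suc-pred-inj l l′ e
    where
    suc-pred-inj : ∀ {x y} → suc a ≤ x → suc a ≤ y → pred x ≡ pred y → x ≡ y
    suc-pred-inj {suc x} {suc y} _ _ e′ = cong suc e′

not-xor-≡ : ∀ {b s} → b ≡ s → not (b xor s) ≡ true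
not-xor-≡ {true}  refl = refl
not-xor-≡ {false} refl = refl

not-xor-≢ : ∀ {b s} → b ≢ s → not (b xor s) ≡ false
not-xor-≢ {true}  {true}  b≢s = ⊥-elim (b≢s refl)
not-xor-≢ {true}  {false} _   = refl
not-xor-≢ {false} {true}  _   = refl
not-xor-≢ {false} {false} b≢s = ⊥-elim (b≢s refl)

module BlockDecomposition (side : ℕ → Bool) (s0 : Bool) where

  pairsOf : List (List ℕ) → List (ℕ × ℕ)
  pairsOf = concatMap cyclePairs

  record Invariant (lo hi : ℕ) (res : List (List ℕ) × List ℕ) : Set where
    field
      start        : ℕ
      pending      : Run lo start (proj₂ res)
      start≤hi     : start ≤ hi
      pendingOther : ∀ {x} → Within lo start x → side x ≢ s0
      startSame    : start < hi → side start ≡ s0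
      permutes     : Permutes start hi (pairsOf (proj₁ res))
      lastToTop    : ∀ {a} → IsLast side s0 lo hi a → relabel (pairsOf (proj₁ res)) a ≡ pred hi

  open Invariant

  invariant-[] : ∀ lo → Invariant lo lo ([] , [])
  invariant-[] lo = record
    { start = lo ; pending = done ; start≤hi = ≤-refl
    ; pendingOther = λ (l , u) → ⊥-elim (<⇒≱ u l)
    ; startSame    = λ lo<lo → ⊥-elim (<-irrefl refl lo<lo)
    ; permutes     = permutes-[] lo
    ; lastToTop    = λ isLast → let (l , u) = IsLast.within isLast in ⊥-elim (<⇒≱ u l) }

  invariant-close : ∀ {lo hi bs pend} → Invariant (suc lo) hi (bs , pend) → side lo ≡ s0 →
                    Invariant lo hi ((lo ∷ pend) ∷ bs , [])
  invariant-close {lo} {hi} {bs} {pend} inv lo-same = record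
    { start = lo ; pending = done ; start≤hi = lo≤hi
    ; pendingOther = λ (l , u) → ⊥-elim (<⇒≱ u l)
    ; startSame    = λ _ → lo-same
    ; permutes     = permutes-++ (<⇒≤ lo<start) (start≤hi inv) block (permutes inv)
    ; lastToTop    = lastToTop′ }
    where
    lo<start : lo < start inv
    lo<start = run-≤ (pending inv)

    lo≤hi : lo ≤ hi
    lo≤hi = <⇒≤ (<-≤-trans lo<start (start≤hi inv))

    block : Permutes lo (start inv) (cyclePairs (lo ∷ pend))
    block = permutes-cycle (pending inv)

    lastToTop′ : ∀ {a} → IsLast side s0 lo hi a →
                 relabel (cyclePairs (lo ∷ pend) ++ pairsOf bs) a ≡ pred hi
    lastToTop′ {a} isLast with within-split (IsLast.within isLast)
    ... | inj₁ refl = begin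
      relabel (cyclePairs (lo ∷ pend) ++ pairsOf bs) lo
        ≡⟨ relabel-++ˡ (cyclePairs (lo ∷ pend)) _ (Permutes.within⇒old block (≤-refl , lo<start)) ⟩
      relabel (cyclePairs (lo ∷ pend)) lo ≡⟨ cycle-head (pending inv) ⟩
      pred (start inv)                    ≡⟨ cong pred start≡hi ⟩
      pred hi                             ∎
      where
      open ≡-Reasoning
      -- otherwise `start` would be a label on side s0 after `lo`
      start≡hi : start inv ≡ hi
      start≡hi with m≤n⇒m<n∨m≡n (start≤hi inv)
      ... | inj₁ start<hi = ⊥-elim (IsLast.after isLast lo<start start<hi (startSame inv start<hi))
      ... | inj₂ start≡hi = start≡hi
    ... | inj₂ w@(l , u) = trans (relabel-++ʳ (cyclePairs (lo ∷ pend)) _ (permutes-fresh block notPending))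
                                 (lastToTop inv (isLast-narrow isLast l))
      where
      notPending : ¬ Within lo (start inv) a
      notPending (_ , a<start) = pendingOther inv (l , a<start) (IsLast.onSide isLast)

  invariant-defer : ∀ {lo hi bs pend} → Invariant (suc lo) hi (bs , pend) → side lo ≢ s0 →
                    Invariant lo hi (bs , lo ∷ pend)
  invariant-defer {lo} {hi} {bs} inv lo-other = record
    { start = start inv ; pending = next (pending inv) ; start≤hi = start≤hi inv
    ; pendingOther = pendingOther′
    ; startSame    = startSame inv
    ; permutes     = permutes inv
    ; lastToTop    = lastToTop′ }
    where
    pendingOther′ : ∀ {x} → Within lo (start inv) x → side x ≢ s0
    pendingOther′ w with within-split w
    ... | inj₁ refl = lo-other
    ... | inj₂ w′   = pendingOther inv w′

    lastToTop′ : ∀ {a} → IsLast side s0 lo hi a → relabel (pairsOf bs) a ≡ pred hi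
    lastToTop′ isLast with within-split (IsLast.within isLast)
    ... | inj₁ refl = ⊥-elim (lo-other (IsLast.onSide isLast))
    ... | inj₂ w    = lastToTop inv (isLast-narrow isLast (proj₁ w))

  invariant : ∀ {lo hi xs} → Run lo hi xs → Invariant lo hi (blocks side s0 xs)
  invariant done = invariant-[] _
  invariant {lo} (next {xs = xs} r) with blocks side s0 xs | invariant r
  ... | (bs , pend) | inv with side lo ≟ᵇ s0
  ...   | yes same rewrite not-xor-≡ same = invariant-close inv same
  ...   | no other rewrite not-xor-≢ other = invariant-defer inv other

blockPairs : (ℕ → Bool) → ℕ → ℕ → List (ℕ × ℕ)
blockPairs side m k = concatMap cyclePairs (proj₁ (blocks side (side m) (map (m +_) (upTo (k ∸ m)))))

module _ (side : ℕ → Bool) {m k : ℕ} (m<k : m < k) where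
  open BlockDecomposition side (side m)
  private
    inv : Invariant m k (blocks side (side m) (map (m +_) (upTo (k ∸ m))))
    inv = invariant (run-labels (<⇒≤ m<k))
    open Invariant inv

    -- m itself opens a block, so nothing is left pending
    start≡m : start ≡ m
    start≡m with m≤n⇒m<n∨m≡n (run-≤ pending)
    ... | inj₁ m<start = ⊥-elim (pendingOther (≤-refl , m<start) refl)
    ... | inj₂ m≡start = sym m≡start

  blockPairs-permutes : Permutes m k (blockPairs side m k)
  blockPairs-permutes = subst (λ lo → Permutes lo k (blockPairs side m k)) start≡m permutes

  blockPairs-last : ∀ {a} → IsLast side (side m) m k a → relabel (blockPairs side m k) a ≡ pred k
  blockPairs-last = lastToTop

relabelT : (ℕ → ℕ) → Tableau → Tableau
relabelT f = map (map f)

relabelT-id : ∀ T → relabelT id T ≡ T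
relabelT-id T = trans (map-cong map-id T) (map-id T)

relabelT-∘ : ∀ g f T → relabelT g (relabelT f T) ≡ relabelT (g ∘ f) T
relabelT-∘ g f T = trans (sym (map-∘ T)) (map-cong (λ row → sym (map-∘ row)) T)

record Relabelling (k : ℕ) (T T′ : Tableau) : Set where
  field
    f         : ℕ → ℕ
    injective : Injective _≡_ _≡_ f
    fixes     : ∀ {x} → k ≤ x → f x ≡ x
    result    : T′ ≡ relabelT f T

relabelling-id : ∀ {k T} → Relabelling k T T
relabelling-id {T = T} = record { f = id ; injective = id ; fixes = λ _ → refl ; result = sym (relabelT-id T) }

relabelling-∘ : ∀ {k k′ T T₁ T₂} → k′ ≤ k → Relabelling k T T₁ → Relabelling k′ T₁ T₂ → Relabelling k T T₂
relabelling-∘ {T = T} k′≤k F G = record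
  { f         = G.f ∘ F.f
  ; injective = F.injective ∘ G.injective
  ; fixes     = λ k≤x → trans (cong G.f (F.fixes k≤x)) (G.fixes (≤-trans k′≤k k≤x))
  ; result    = trans G.result (trans (cong (relabelT G.f) F.result) (relabelT-∘ G.f F.f T)) }
  where
  module F = Relabelling F
  module G = Relabelling G

lowest-< : ∀ {d k} → 1 ≤ d → 2 ≤ k → (k ∸ d) ⊔ 1 < k
lowest-< {d} {suc k} 1≤d (s≤s 1≤k) = s≤s (⊔-lub (∸-monoʳ-≤ (suc k) 1≤d) 1≤k)

psiK-blocks : ∀ d k T → 3 ≤ k →
  psiK d k T ≡ relabelT (relabel (blockPairs (underB T k) ((k ∸ d) ⊔ 1) k)) T
psiK-blocks d (suc (suc (suc k))) T _ = refl
psiK-blocks d (suc (suc zero)) T (s≤s (s≤s ()))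
psiK-blocks d (suc zero) T (s≤s ())

psiK-small : ∀ d k T → k ≤ 2 → Relabelling k T (psiK d k T)
psiK-small d k T k≤2 = record
  { f = id ; injective = id ; fixes = λ _ → refl ; result = trans psiK≡T (sym (relabelT-id T)) }
  where
  psiK≡T : psiK d k T ≡ T
  psiK≡T rewrite ≤⇒≤ᵇ-true k≤2 = refl

psiK-large : ∀ d k T → 1 ≤ d → 3 ≤ k → Relabelling k T (psiK d k T)
psiK-large d k T 1≤d 3≤k = record
  { f         = relabel ps
  ; injective = permutes-injective π
  ; fixes     = λ k≤x → permutes-fixes π (λ (_ , x<k) → <⇒≱ x<k k≤x)
  ; result    = psiK-blocks d k T 3≤k }
  where
  ps = blockPairs (underB T k) ((k ∸ d) ⊔ 1) k
  π = blockPairs-permutes (underB T k) (lowest-< 1≤d (<⇒≤ 3≤k))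

psiK-relabelling : ∀ d k T → 1 ≤ d → Relabelling k T (psiK d k T)
psiK-relabelling d k T 1≤d with k ≤? 2
... | yes k≤2 = psiK-small d k T k≤2
... | no k≰2  = psiK-large d k T 1≤d (≰⇒> k≰2)

psi-relabelling : ∀ d k T → 1 ≤ d → Relabelling k T (psi d k T)
psi-relabelling d zero    T _   = relabelling-id
psi-relabelling d (suc k) T 1≤d =
  relabelling-∘ (n≤1+n k) (psiK-relabelling d (suc k) T 1≤d) (psi-relabelling d k (psiK d (suc k) T) 1≤d)

psiK-last : ∀ d k T → 1 ≤ d → 2 ≤ k → ∀ {a} →
  let m = (k ∸ d) ⊔ 1 in IsLast (underB T k) (underB T k m) m k a →
  Σ (Relabelling k T (psiK d k T)) λ R → Relabelling.f R a ≡ pred k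
psiK-last d k T 1≤d 2≤k {a} isLast with k ≤? 2
... | yes k≤2 = psiK-small d k T k≤2 , a≡1
  where
  -- here k = 2, and 1 ≤ m ≤ a < 2
  a≡1 : a ≡ pred k
  a≡1 = ≤-antisym (pred-mono-≤ (proj₂ (IsLast.within isLast)))
          (≤-trans (pred-mono-≤ k≤2) (≤-trans (m≤n⊔m (k ∸ d) 1) (proj₁ (IsLast.within isLast))))
... | no k≰2  = psiK-large d k T 1≤d (≰⇒> k≰2) ,
                blockPairs-last (underB T k) (lowest-< 1≤d 2≤k) isLast

psi-last : ∀ d n T → 1 ≤ d → 2 ≤ n → ∀ {a} →
  let m = (n ∸ d) ⊔ 1 in IsLast (underB T n) (underB T n m) m n a →
  Σ (ℕ → ℕ) λ h → Injective _≡_ _≡_ h × h a ≡ pred n × h n ≡ n × psi d n T ≡ relabelT h T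
psi-last d (suc n) T 1≤d 2≤n isLast =
  H.f , H.injective , trans (cong G.f Fa) (G.fixes ≤-refl) , H.fixes ≤-refl , H.result
  where
  top = psiK-last d (suc n) T 1≤d 2≤n isLast
  Fa = proj₂ top
  rest = psi-relabelling d n (psiK d (suc n) T) 1≤d
  module G = Relabelling rest
  module H = Relabelling (relabelling-∘ (n≤1+n n) (proj₁ top) rest)

≡ᵇ-relabel : ∀ {f} → Injective _≡_ _≡_ f → ∀ y x → (f y ≡ᵇ f x) ≡ (y ≡ᵇ x)
≡ᵇ-relabel {f} f-inj y x with y ≡ᵇ x in y≟x
... | true  = ≡⇒≡ᵇ-true (cong f (≡ᵇ-true⇒≡ {y} {x} y≟x))
... | false = ≢⇒≡ᵇ-false (≡ᵇ-false⇒≢ {y} {x} y≟x ∘ f-inj)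

findIn-relabel : ∀ {f} → Injective _≡_ _≡_ f → ∀ y row c → findIn (f y) (map f row) c ≡ findIn y row c
findIn-relabel f-inj y [] c = refl
findIn-relabel f-inj y (x ∷ row) c rewrite ≡ᵇ-relabel f-inj y x with y ≡ᵇ x
... | true  = refl
... | false = findIn-relabel f-inj y row (suc c)

posFrom-relabel : ∀ {f} → Injective _≡_ _≡_ f → ∀ y T r → posFrom (f y) (relabelT f T) r ≡ posFrom y T r
posFrom-relabel f-inj y [] r = refl
posFrom-relabel f-inj y (row ∷ T) r rewrite findIn-relabel f-inj y row 1 with findIn y row 1
... | just c  = refl
... | nothing = posFrom-relabel f-inj y T (suc r)

rowOfPos : Maybe (ℕ × ℕ) → ℕ
rowOfPos (just (r , _)) = r
rowOfPos nothing        = 0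

rowOf-pos : ∀ T k → rowOf T k ≡ rowOfPos (pos T k)
rowOf-pos T k with pos T k
... | just _  = refl
... | nothing = refl

rowOf-relabel : ∀ {f} → Injective _≡_ _≡_ f → ∀ T y → rowOf (relabelT f T) (f y) ≡ rowOf T y
rowOf-relabel {f} f-inj T y = begin
  rowOf (relabelT f T) (f y)            ≡⟨ rowOf-pos (relabelT f T) (f y) ⟩
  rowOfPos (pos (relabelT f T) (f y))   ≡⟨ cong rowOfPos (posFrom-relabel f-inj y T 1) ⟩
  rowOfPos (pos T y)                    ≡⟨ sym (rowOf-pos T y) ⟩
  rowOf T y                       ∎
  where open ≡-Reasoning

psi-rows : ∀ d n T → 1 ≤ d → 2 ≤ n → ∀ {a} →
  let m = (n ∸ d) ⊔ 1 in IsLast (underB T n) (underB T n m) m n a →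
  rowOf (psi d n T) (pred n) ≡ rowOf T a × rowOf (psi d n T) n ≡ rowOf T n
psi-rows d n T 1≤d 2≤n {a} isLast with psi-last d n T 1≤d 2≤n isLast
... | h , h-inj , ha , hn , ψ≡ rewrite ψ≡ =
  trans (cong (rowOf (relabelT h T)) (sym ha)) (rowOf-relabel h-inj T a) ,
  trans (cong (rowOf (relabelT h T)) (sym hn)) (rowOf-relabel h-inj T n)

record HasCell (T : Tableau) (r c : ℕ) : Set where
  constructor occupied
  field
    label : ℕ
    holds : entry T r c ≡ just label

at-∈ : ∀ {A : Set} (xs : List A) i {v} → at xs i ≡ just v → v ∈ xs
at-∈ (x ∷ xs) (suc zero)    refl = here refl
at-∈ (x ∷ xs) (suc (suc i)) e    = there (at-∈ xs (suc i) e)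

∈-at : ∀ {A : Set} {xs : List A} {v} → v ∈ xs → ∃ λ i → at xs (suc i) ≡ just v
∈-at (here refl) = 0 , refl
∈-at (there v∈xs) = let (i , e) = ∈-at v∈xs in suc i , e

at-length : ∀ {A : Set} (xs : List A) i {v} → at xs i ≡ just v → 1 ≤ i × i ≤ length xs
at-length (x ∷ xs) (suc zero)    e = s≤s z≤n , s≤s z≤n
at-length (x ∷ xs) (suc (suc i)) e = s≤s z≤n , s≤s (proj₂ (at-length xs (suc i) e))

length-at : ∀ {A : Set} (xs : List A) i → 1 ≤ i → i ≤ length xs → ∃ λ v → at xs i ≡ just v
length-at (x ∷ xs) (suc zero)    _ _          = x , refl
length-at (x ∷ xs) (suc (suc i)) _ (s≤s i≤n) = length-at xs (suc i) (s≤s z≤n) i≤n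

entry-row : ∀ T r c {v} → entry T r c ≡ just v → ∃ λ row → at T r ≡ just row × at row c ≡ just v
entry-row T r c e with at T r
entry-row T r c e  | just row = row , refl , e
entry-row T r c () | nothing

cell-row≥1 : ∀ T r c {v} → entry T r c ≡ just v → 1 ≤ r
cell-row≥1 T r c e = let (_ , eT , _) = entry-row T r c e in proj₁ (at-length T r eT)

cell-column≥1 : ∀ T r c {v} → entry T r c ≡ just v → 1 ≤ c
cell-column≥1 T r c e = let (row , _ , eRow) = entry-row T r c e in proj₁ (at-length row c eRow)

entry-at : ∀ T r {row} c → at T r ≡ just row → entry T r c ≡ at row c
entry-at T r c e rewrite e = refl

cell-∈ : ∀ T r c {v} → entry T r c ≡ just v → v ∈ concat T
cell-∈ T r c e = let (row , eT , eRow) = entry-row T r c e in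
  ∈-concat⁺′ (at-∈ row c eRow) (at-∈ T r eT)

∈-cell : ∀ T {v} → v ∈ concat T → ∃₂ λ r c → entry T r c ≡ just v
∈-cell T v∈T with ∈-concat⁻′ T v∈T
... | row , v∈row , row∈T =
  let (i , eT) = ∈-at row∈T ; (j , eRow) = ∈-at v∈row in
  suc i , suc j , trans (entry-at T (suc i) (suc j) eT) eRow

Unique-++⁻ : ∀ (xs : List ℕ) {ys} → Unique (xs ++ ys) →
             Unique xs × Unique ys × (∀ {v} → v ∈ xs → v ∉ ys)
Unique-++⁻ []       u          = [] , u , λ ()
Unique-++⁻ (x ∷ xs) (x∉ ∷ u) with Unique-++⁻ xs u
... | uxs , uys , apart = All.++⁻ˡ xs x∉ ∷ uxs , uys , λ
  { (here refl) v∈ys → lookup (All.++⁻ʳ xs x∉) v∈ys refl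
  ; (there v∈xs)     → apart v∈xs }

findIn-∉ : ∀ {v} row c → v ∉ row → findIn v row c ≡ nothing
findIn-∉ []        c v∉ = refl
findIn-∉ {v} (x ∷ row) c v∉ rewrite ≢⇒≡ᵇ-false (v∉ ∘ here) = findIn-∉ row (suc c) (v∉ ∘ there)

findIn-at : ∀ {v} row c j → Unique row → at row (suc j) ≡ just v → findIn v row c ≡ just (c + j)
findIn-at {v} (x ∷ row) c zero    _          refl rewrite ≡⇒≡ᵇ-true {v} refl | +-identityʳ c = refl
findIn-at {v} (x ∷ row) c (suc j) (x∉ ∷ u) e
  rewrite ≢⇒≡ᵇ-false (λ v≡x → lookup x∉ (at-∈ row (suc j) e) (sym v≡x)) | +-suc c j =
  findIn-at row (suc c) j u e

posFrom-at : ∀ {v} T r i j {row} → Unique (concat T) → at T (suc i) ≡ just row → at row (suc j) ≡ just v →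
             posFrom v T r ≡ just (r + i , suc j)
posFrom-at (row₀ ∷ T) r zero j u refl e with Unique-++⁻ row₀ u
... | u₀ , _ , _ rewrite findIn-at row₀ 1 j u₀ e | +-identityʳ r = refl
posFrom-at {v} (row₀ ∷ T) r (suc i) j {row} u eT e with Unique-++⁻ row₀ u
... | _ , uT , apart
  rewrite findIn-∉ row₀ 1 (λ v∈row₀ → apart v∈row₀ (∈-concat⁺′ (at-∈ row (suc j) e) (at-∈ T (suc i) eT)))
        | +-suc r i = posFrom-at T (suc r) i j uT eT e

pos-cell : ∀ T r c {v} → Unique (concat T) → entry T r c ≡ just v → pos T v ≡ just (r , c)
pos-cell T r c u e with entry-row T r c e
pos-cell T (suc i) (suc j) u e | row , eT , eRow = posFrom-at T 1 i j u eT eRow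
pos-cell T zero    c       u e | row , () , _
pos-cell T (suc i) zero    u e | row , _ , ()

first-row-longest : ∀ (row₀ : List ℕ) T R {rowR} → Linked _≥_ (map length (row₀ ∷ T)) →
                    at (row₀ ∷ T) R ≡ just rowR → length rowR ≤ length row₀
first-row-longest row₀ T          (suc zero)    _        refl = ≤-refl
first-row-longest row₀ (row₁ ∷ T) (suc (suc R)) (h ∷ lk) eR   =
  ≤-trans (first-row-longest row₁ T (suc R) lk eR) h

rows-shrink : ∀ T r R {rowR} → Linked _≥_ (map length T) → 1 ≤ r → r ≤ R → at T R ≡ just rowR →
              ∃ λ row → at T r ≡ just row × length rowR ≤ length row
rows-shrink (row₀ ∷ T) (suc zero) R lk _ _ eR = row₀ , refl , first-row-longest row₀ T R lk eR
rows-shrink (row₀ ∷ row₁ ∷ T) (suc (suc r)) (suc (suc R)) (_ ∷ lk) _ (s≤s r≤R) eR =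
  rows-shrink (row₁ ∷ T) (suc r) (suc R) lk (s≤s z≤n) r≤R eR
rows-shrink [] (suc zero) (suc R) _ _ _ ()
rows-shrink (row₀ ∷ []) (suc (suc r)) (suc (suc R)) _ _ _ ()
rows-shrink (row₀ ∷ []) (suc (suc r)) (suc zero) _ _ (s≤s ()) _

cell-closed : ∀ T {R C r c} → Linked _≥_ (map length T) → HasCell T R C →
              1 ≤ r → r ≤ R → 1 ≤ c → c ≤ C → HasCell T r c
cell-closed T {R} {C} {r} {c} lk (occupied v e) 1≤r r≤R 1≤c c≤C =
  let (rowR , eR , eC)      = entry-row T R C e
      (row , er , shorter) = rows-shrink T r R lk 1≤r r≤R eR
      (w , ec)             = length-at row c 1≤c (≤-trans c≤C (≤-trans (proj₂ (at-length rowR C eC)) shorter))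
  in occupied w (trans (entry-at T r c er) ec)

-- For k in cell (rk, ck) the path π(T,k) starts at the lattice point (ck-1, rk-1);
-- `pathX T rk ck r` is the x-coordinate x_r of its down-step from height r to r-1.
pathX : Tableau → ℕ → ℕ → ℕ → Maybe ℕ
pathX T rk ck r = downX (suc ((ck ∸ 1) + (rk ∸ 1))) T (ck ∸ 1) (rk ∸ 1) r

-- At the lattice point (x, y) the cell
-- B = (row y, column x+1) to its lower right exists all along the path, so the
-- path never stops early; it steps left or down.
module Path (T : Tableau) (shrink : Linked _≥_ (map length T)) where

  step-cases : ∀ x y → HasCell T y (suc x) → (stepAt T x y ≡ left × 1 ≤ x) ⊎ stepAt T x y ≡ down
  step-cases x y (occupied _ eB) with entry T (suc y) x in eL | entry T y (suc x)
  ... | just l  | just b with b <ᵇ l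
  ...   | true  = inj₁ (refl , cell-column≥1 T (suc y) x eL)
  ...   | false = inj₂ refl
  step-cases x y (occupied _ eB) | nothing | just _ = inj₂ refl
  step-cases x y (occupied _ ())  | _       | nothing

  cell-left : ∀ {x y} → 1 ≤ y → HasCell T y (suc (suc x)) → HasCell T y (suc x)
  cell-left 1≤y B = cell-closed T shrink B 1≤y ≤-refl (s≤s z≤n) (n≤1+n _)

  cell-down : ∀ {x y} → 1 ≤ y → HasCell T (suc y) (suc x) → HasCell T y (suc x)
  cell-down 1≤y B = cell-closed T shrink B 1≤y (n≤1+n _) (s≤s z≤n) ≤-refl

  private
    -- reaching height r from height y > r needs one more down-step
    fuel-down : ∀ {x y f} → x + suc y < suc f → x + y < f
    fuel-down {x} {y} {f} fuel = ≤-pred (subst (_< suc f) (+-suc x y) fuel)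

  downX-defined : ∀ f x y r → 1 ≤ r → r ≤ y → x + y < f → HasCell T y (suc x) →
                  ∃ λ X → downX f T x y r ≡ just X × X ≤ x
  downX-defined (suc f) x y r 1≤r r≤y fuel B with stepAt T x y | step-cases x y B
  downX-defined (suc f) (suc x) y r 1≤r r≤y fuel B | .left | inj₁ (refl , _) =
    let (X , e , X≤x) = downX-defined f x y r 1≤r r≤y (≤-pred fuel) (cell-left (≤-trans 1≤r r≤y) B)
    in X , e , m≤n⇒m≤1+n X≤x
  downX-defined (suc f) x y r 1≤r r≤y fuel B | .down | inj₂ refl with y ≡ᵇ r in y≟r
  ... | true = x , refl , ≤-refl
  downX-defined (suc f) x (suc y) r 1≤r r≤y fuel B | .down | inj₂ refl | false =
    downX-defined f x y r 1≤r r≤y′ (fuel-down {x} fuel) (cell-down (≤-trans 1≤r r≤y′) B)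
    where
    r≤y′ : r ≤ y
    r≤y′ = ≤-pred (≤∧≢⇒< r≤y (≡ᵇ-false⇒≢ {suc y} {r} y≟r ∘ sym))

  downX-monotone : ∀ f x y r {X X′} → 1 ≤ r → suc r ≤ y → x + y < f → HasCell T y (suc x) →
                   downX f T x y (suc r) ≡ just X′ → downX f T x y r ≡ just X → X ≤ X′
  downX-monotone (suc f) x y r 1≤r r<y fuel B e′ e with stepAt T x y | step-cases x y B
  downX-monotone (suc f) (suc x) y r 1≤r r<y fuel B e′ e | .left | inj₁ (refl , _) =
    downX-monotone f x y r 1≤r r<y (≤-pred fuel) (cell-left (≤-trans 1≤r (<⇒≤ r<y)) B) e′ e
  downX-monotone (suc f) x y r 1≤r r<y fuel B e′ e | .down | inj₂ refl
    rewrite ≢⇒≡ᵇ-false (<⇒≢ r<y ∘ sym) with y ≡ᵇ suc r in y≟r+1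
  downX-monotone (suc f) x (suc y) r {X} 1≤r r<y fuel B e′ e | .down | inj₂ refl | true
    rewrite suc-injective (≡ᵇ-true⇒≡ {suc y} {suc r} y≟r+1) =
    -- the path reaches height r at x = X′ and continues from (X′, r)
    let (X″ , e″ , X″≤x) = downX-defined f x r r 1≤r ≤-refl (fuel-down {x} fuel) (cell-down 1≤r B)
    in subst (_≤ _) (just-injective (trans (sym e″) e)) (subst (X″ ≤_) (just-injective e′) X″≤x)
  downX-monotone (suc f) x (suc y) r 1≤r r<y fuel B e′ e | .down | inj₂ refl | false =
    downX-monotone f x y r 1≤r r<y′ (fuel-down {x} fuel) (cell-down (≤-trans 1≤r (<⇒≤ r<y′)) B) e′ e
    where
    r<y′ : suc r ≤ y
    r<y′ = ≤-pred (≤∧≢⇒< r<y (≡ᵇ-false⇒≢ {suc y} {suc r} y≟r+1 ∘ sym))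

  pathX-defined : ∀ {rk ck r} → HasCell T rk ck → 1 ≤ r → r < rk →
                  ∃ λ X → pathX T rk ck r ≡ just X × X < ck
  pathX-defined {suc rk} {suc ck} {r} K 1≤r (s≤s r≤rk) =
    let (X , e , X≤ck) = downX-defined (suc (ck + rk)) ck rk r 1≤r r≤rk ≤-refl (cell-down (≤-trans 1≤r r≤rk) K)
    in X , e , s≤s X≤ck
  pathX-defined {rk} {zero} (occupied _ e) _ _ = ⊥-elim (<⇒≱ (cell-column≥1 T rk 0 e) z≤n)

  pathX-monotone : ∀ {rk ck r X X′} → HasCell T rk ck → 1 ≤ r → suc r < rk →
                   pathX T rk ck (suc r) ≡ just X′ → pathX T rk ck r ≡ just X → X ≤ X′
  pathX-monotone {suc rk} {suc ck} {r} K 1≤r (s≤s r<rk) =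
    downX-monotone (suc (ck + rk)) ck rk r 1≤r r<rk ≤-refl (cell-down (≤-trans 1≤r (<⇒≤ r<rk)) K)
  pathX-monotone {rk} {zero} (occupied _ e) _ _ = ⊥-elim (<⇒≱ (cell-column≥1 T rk 0 e) z≤n)

underB-row : ∀ T k ℓ {rk ck r c} → pos T k ≡ just (rk , ck) → pos T ℓ ≡ just (r , c) →
             underB T k ℓ ≡ true → r < rk
underB-row T k ℓ pk pℓ e with pos T k | pos T ℓ
underB-row T k ℓ {rk} {ck} {r} {c} refl refl e | .(just (rk , ck)) | .(just (r , c)) with r <ᵇ rk in r<ᵇrk
... | true  = <ᵇ⇒< r rk (≡true⇒T r<ᵇrk)
underB-row T k ℓ refl refl () | _ | _ | false

underB-below : ∀ T k ℓ {rk ck r c X} → pos T k ≡ just (rk , ck) → pos T ℓ ≡ just (r , c) →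
               r < rk → pathX T rk ck r ≡ just X → underB T k ℓ ≡ (X ≤ᵇ c ∸ 1)
underB-below T k ℓ pk pℓ r<rk eX with pos T k | pos T ℓ
underB-below T k ℓ {rk} {ck} {r} {c} refl refl r<rk eX | .(just (rk , ck)) | .(just (r , c))
  rewrite T⇒≡true (<⇒<ᵇ r<rk) | eX = refl

module StandardTableau {n sh T} (partition : IsPartition sh n) (syt : IsSYT sh T) where

  shrink : Linked _≥_ (map length T)
  shrink = subst (Linked _≥_) (sym (proj₁ syt)) (proj₁ (proj₂ partition))

  private
    labels : concat T ↭ map suc (upTo (sum sh))
    labels = proj₁ (proj₂ syt)

    size : sum sh ≡ n
    size = proj₂ (proj₂ partition)

  distinct : Unique (concat T)
  distinct = Unique-resp-↭ (setoid ℕ) (↭⇒↭ₛ (↭-sym labels)) (Unique.map⁺ suc-injective (Unique.upTo⁺ (sum sh)))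

  columns : ∀ r c a b → entry T r c ≡ just a → entry T (suc r) c ≡ just b → a < b
  columns = proj₂ (proj₂ (proj₂ syt))

  cell-≤n : ∀ r c {v} → entry T r c ≡ just v → v ≤ n
  cell-≤n r c e with ∈-map⁻ suc (∈-resp-↭ labels (cell-∈ T r c e))
  ... | i , i∈ , refl = subst (suc i ≤_) size (∈-upTo⁻ i∈)

  cell-of : ∀ {v} → 1 ≤ v → v ≤ n → ∃₂ λ r c → entry T r c ≡ just v
  cell-of {suc v} _ v≤n = ∈-cell T (∈-resp-↭ (↭-sym labels) (∈-map⁺ suc (∈-upTo⁺ (subst (suc v ≤_) (sym size) v≤n))))

  -- Otherwise the
  -- label b above a would be under the path, forcing x_{r+1} ≤ c-1 < x_r.
  notUnder⇒notAbove : ∀ {a} rn cn r c → entry T rn cn ≡ just n → entry T r c ≡ just a →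
                      underB T n a ≡ false → (∀ {x} → a < x → x < n → underB T n x ≡ true) → rn ≤ r
  notUnder⇒notAbove {a} rn cn r c en ea a-out between-in with rn ≤? r
  ... | yes rn≤r = rn≤r
  ... | no rn≰r = ⊥-elim (<⇒≱ a-right (≤-trans X≤X′ b-left))
    where
    open Path T shrink
    r<rn = ≰⇒> rn≰r
    1≤r = cell-row≥1 T r c ea
    1≤c = cell-column≥1 T r c ea
    pn = pos-cell T rn cn distinct en
    pa = pos-cell T r c distinct ea
    N : HasCell T rn cn
    N = occupied n en

    -- the down-step of π(T,n) at the height of a lies to the right of a's cell
    downStep = pathX-defined N 1≤r r<rn
    X = proj₁ downStep
    eX = proj₁ (proj₂ downStep)

    a-right : c ∸ 1 < X
    a-right = ≰⇒> (≡false⇒¬T (trans (sym (underB-below T n a pn pa r<rn eX)) a-out) ∘ ≤⇒≤ᵇ)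

    c<cn : c < cn
    c<cn = ≤-<-trans (subst (_≤ X) (m+[n∸m]≡n 1≤c) a-right) (proj₂ (proj₂ downStep))

    above = cell-closed T shrink N (s≤s z≤n) r<rn 1≤c (<⇒≤ c<cn)
    b = HasCell.label above
    eb = HasCell.holds above
    pb = pos-cell T (suc r) c distinct eb

    b≢n : b ≢ n
    b≢n b≡n = <⇒≢ c<cn (cong proj₂ (just-injective (trans (sym (subst (λ v → pos T v ≡ _) b≡n pb)) pn)))

    b-in : underB T n b ≡ true
    b-in = between-in (columns r c a b ea eb) (≤∧≢⇒< (cell-≤n (suc r) c eb) b≢n)

    r+1<rn = underB-row T n b pn pb b-in
    downStep′ = pathX-defined N (s≤s z≤n) r+1<rn
    X′ = proj₁ downStep′
    eX′ = proj₁ (proj₂ downStep′)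

    b-left : X′ ≤ c ∸ 1
    b-left = ≤ᵇ⇒≤ X′ (c ∸ 1) (≡true⇒T (trans (sym (underB-below T n b pn pb r+1<rn eX′)) b-in))

    X≤X′ : X ≤ X′
    X≤X′ = pathX-monotone N 1≤r r+1<rn eX′ eX

  last-under⇔lower : ∀ {b m a} → 1 ≤ m → IsLast (underB T n) b m n a →
                     (b ≡ true) ⇔ (rowOf T a < rowOf T n)
  last-under⇔lower {b} {m} {a} 1≤m isLast = mk⇔ to from
    where
    open IsLast isLast
    cellA = cell-of (≤-trans 1≤m (proj₁ within)) (<⇒≤ (proj₂ within))
    cellN = cell-of (≤-trans 1≤m (<⇒≤ (≤-<-trans (proj₁ within) (proj₂ within)))) ≤-refl
    ra = proj₁ cellA
    ca = proj₁ (proj₂ cellA)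
    ea = proj₂ (proj₂ cellA)
    rn = proj₁ cellN
    cn = proj₁ (proj₂ cellN)
    en = proj₂ (proj₂ cellN)
    pa = pos-cell T ra ca distinct ea
    pn = pos-cell T rn cn distinct en

    rows : rowOf T a ≡ ra × rowOf T n ≡ rn
    rows = trans (rowOf-pos T a) (cong rowOfPos pa) , trans (rowOf-pos T n) (cong rowOfPos pn)

    to : b ≡ true → rowOf T a < rowOf T n
    to b≡true rewrite proj₁ rows | proj₂ rows = underB-row T n a pn pa (trans onSide b≡true)

    from : rowOf T a < rowOf T n → b ≡ true
    from lower = ≢false⇒≡true λ b≡false →
      <⇒≱ (subst₂ _<_ (proj₁ rows) (proj₂ rows) lower)
          (notUnder⇒notAbove rn cn ra ca en ea (trans onSide b≡false)
            (λ a<x x<n → ≢false⇒≡true (after a<x x<n ∘ λ x-out → trans x-out (sym b≡false))))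

lemma2 : (n d : ℕ) → 2 ≤ n → 1 ≤ d → d ≤ n →
         (sh : List ℕ) → IsPartition sh n →
         (T : Tableau) → IsSYT sh T →
         (underB T n ((n ∸ d) ⊔ 1) ≡ true)
           ⇔ (rowOf (psi d n T) (n ∸ 1) < rowOf (psi d n T) n)
lemma2 n@(suc _) d 2≤n 1≤d _ sh partition T syt =
  mk⇔ (λ m-under → subst₂ _<_ (sym (proj₁ rows)) (sym (proj₂ rows)) (Equivalence.to core m-under))
      (λ descent → Equivalence.from core (subst₂ _<_ (proj₁ rows) (proj₂ rows) descent))
  where
  open StandardTableau partition syt
  last = lastOnSide (underB T n) (lowest-< {d} {n} 1≤d 2≤n)
  core = last-under⇔lower (m≤n⊔m (n ∸ d) 1) (proj₂ last)
  rows = psi-rows d n T 1≤d 2≤n (proj₂ last)
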